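{- The logic $\mathcal{L}$ is non-compact: there exists an infinite set $\Phi\subseteq\mathcal{L}$ such that every finite subset of $\Phi$ has a model (a WTS $\mathcal{M}$ and a state $s$ satisfying all its formulae), but $\Phi$ itself has no model.
   Context: Fix a countable set $\mathcal{AP}$ of atomic propositions. A weighted transition system (WTS) is a triple $\mathcal{M}=(S,\rightarrow,\ell)$ where $S$ is a non-empty set of states, $\rightarrow\subseteq S\times\mathbb{R}_{\ge 0}\times S$ is a transition relation (write $s\xrightarrow{r}t$), and $\ell:S\to 2^{\mathcal{AP}}$ is a labeling. For $s\in S$, $T\subseteq S$ let $\theta(s)(T)=\{r\mid \exists t\in T,\ s\xrightarrow{r}t\}$; $\theta^-(s)(T)=-\infty$ if $\theta(s)(T)=\emptyset$, else $\inf\theta(s)(T)$; $\theta^+(s)(T)=\infty$ if $\theta(s)(T)=\emptyset$, else $\sup\theta(s)(T)$. Formulae of $\mathcal{L}$: $\varphi::= p\mid\neg\varphi\mid\varphi\wedge\varphi\mid L_r\varphi\mid M_r\varphi$ with $p\in\mathcal{AP}$, $r\in\mathbb{Q}_{\ge0}$. Semantics: $\mathcal{M},s\models p$ iff $p\in\ell(s)$; Boolean cases as usual; $\mathcal{M},s\models L_r\varphi$ iff $\theta^-(s)([\![\varphi]\!])\ge r$; $\mathcal{M},s\models M_r\varphi$ iff $\theta^+(s)([\![\varphi]\!])\le r$, where $[\![\varphi]\!]=\{s\in S\mid\mathcal{M},s\models\varphi\}$. -}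

module Defs where

open import Level using (Level; 0ℓ) renaming (suc to lsuc)
open import Data.Nat using (ℕ)
open import Data.Rational using (ℚ; 0ℚ; _<_; _≤_)
open import Data.Product using (Σ; ∃; ∃-syntax; _×_; _,_)
open import Data.Sum using (_⊎_)
open import Data.List using (List)
open import Data.List.Membership.Propositional using (_∈_)
open import Data.List.Relation.Unary.All using (All)
open import Relation.Nullary using (¬_)
open import Relation.Binary.PropositionalEquality using (_≡_)
open import Function using (_⇔_)
open import Function.Definitions using (Injective)

-- Real numbers as (constructive) Dedekind cuts of ℚ.
-- lower q  means  q < x ;  upper q  means  x < q.

record ℝ : Set₁ where
  field
    lower      : ℚ → Set
    upper      : ℚ → Set
    inhabitedˡ : ∃[ q ] lower q
    inhabitedᵘ : ∃[ q ] upper q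
    roundedˡ   : ∀ q → lower q ⇔ (∃[ r ] (q < r × lower r))
    roundedᵘ   : ∀ q → upper q ⇔ (∃[ r ] (r < q × upper r))
    disjoint   : ∀ q → ¬ (lower q × upper q)
    located    : ∀ q r → q < r → lower q ⊎ upper r

open ℝ public

_≤ʳ_ : ℚ → ℝ → Set
q ≤ʳ x = ¬ upper x q

_≤ᵣ_ : ℝ → ℚ → Set
x ≤ᵣ q = ¬ lower x q

AP : Set
AP = ℕ

record WTS : Set₂ where
  field
    State  : Set₁
    _⟶[_]_ : State → ℝ → State → Set₁
    weight≥0 : ∀ {s r t} → s ⟶[ r ] t → 0ℚ ≤ʳ r
    label  : State → AP → Set      -- ℓ(s) ⊆ AP as a predicate

open WTS public

data Form : Set where
  atom : AP → Form
  ¬'_  : Form → Form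
  _∧'_ : Form → Form → Form
  L    : (r : ℚ) → 0ℚ ≤ r → Form → Form
  M    : (r : ℚ) → 0ℚ ≤ r → Form → Form

θ : (𝓜 : WTS) → State 𝓜 → (State 𝓜 → Set₁) → ℝ → Set₁
θ 𝓜 s T r = ∃[ t ] (T t × _⟶[_]_ 𝓜 s r t)

-- θ⁻(s)(T) ≥ q, where θ⁻ = -∞ if θ(s)(T) = ∅ and inf θ(s)(T) otherwise.
-- Since q ≥ 0 > -∞, this holds iff θ(s)(T) ≠ ∅ and q is a lower bound
-- of θ(s)(T) (inf A ≥ q  ⇔  ∀ a ∈ A, a ≥ q).
θ⁻≥ : (𝓜 : WTS) → State 𝓜 → (State 𝓜 → Set₁) → ℚ → Set₁
θ⁻≥ 𝓜 s T q = (∃[ r ] θ 𝓜 s T r) × (∀ r → θ 𝓜 s T r → q ≤ʳ r)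

-- θ⁺(s)(T) ≤ q, where θ⁺ = +∞ if θ(s)(T) = ∅ and sup θ(s)(T) otherwise.
-- Holds iff θ(s)(T) ≠ ∅ and q is an upper bound of θ(s)(T).
θ⁺≤ : (𝓜 : WTS) → State 𝓜 → (State 𝓜 → Set₁) → ℚ → Set₁
θ⁺≤ 𝓜 s T q = (∃[ r ] θ 𝓜 s T r) × (∀ r → θ 𝓜 s T r → r ≤ᵣ q)

infix 4 _,_⊨_

_,_⊨_ : (𝓜 : WTS) → State 𝓜 → Form → Set₁
𝓜 , s ⊨ atom p     = Level.Lift _ (label 𝓜 s p)
𝓜 , s ⊨ ¬' φ       = ¬ (𝓜 , s ⊨ φ)
𝓜 , s ⊨ φ ∧' ψ     = (𝓜 , s ⊨ φ) × (𝓜 , s ⊨ ψ)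
𝓜 , s ⊨ L r _ φ    = θ⁻≥ 𝓜 s (λ t → 𝓜 , t ⊨ φ) r
𝓜 , s ⊨ M r _ φ    = θ⁺≤ 𝓜 s (λ t → 𝓜 , t ⊨ φ) r

FormSet : Set₁
FormSet = Form → Set

HasModel : FormSet → Set₂
HasModel Γ = ∃[ 𝓜 ] ∃[ s ] (∀ φ → Γ φ → 𝓜 , s ⊨ φ)

⟦_⟧ : List Form → FormSet
⟦ xs ⟧ φ = φ ∈ xs

Infinite : FormSet → Set
Infinite Φ = Σ (ℕ → Form) (λ f → Injective _≡_ _≡_ f × (∀ n → Φ (f n)))

FinitelySatisfiable : FormSet → Set₂
FinitelySatisfiable Φ = (xs : List Form) → All Φ xs → HasModel ⟦ xs ⟧

module Submission where

-- Take Φ = { L_n ⊤ | n ∈ ℕ }.  A state satisfies L_n ⊤ iff it has an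
-- outgoing transition and every outgoing transition has weight ≥ n.
--
-- * Finitely many of these formulae mention only indices n ≤ N for some N,
--   and the one-state WTS whose only transition is a self-loop of weight N
--   satisfies all of them.
-- * A state satisfying L_0 ⊤ has a transition of some real weight r; by the
--   Archimedean property r < n for some natural n, so L_n ⊤ fails there.

open import Defs
open import Data.Product using (∃; ∃-syntax; _×_; _,_)
open import Relation.Nullary using (¬_)
open import Data.Unit.Polymorphic using (⊤; tt)
open import Data.Nat as ℕ using (ℕ; suc)
import Data.Nat.Properties as ℕP
open import Data.Integer as ℤ using (+_; -[1+_])
import Data.Integer.Properties as ℤP
open import Data.Rational as ℚ using (ℚ; mkℚ; 0ℚ; 1ℚ; *≤*; *<*)
import Data.Rational.Properties as ℚP
open import Data.Nat.Coprimality using (1-coprimeTo) renaming (sym to coprime-sym)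
open import Data.Sum using (_⊎_; inj₁; inj₂)
open import Data.List using (List; []; _∷_)
open import Data.List.Relation.Unary.All as All using (All; []; _∷_)
open import Relation.Binary.PropositionalEquality using (_≡_; refl; sym; subst; cong)
open import Relation.Binary.Definitions using (tri<; tri≈; tri>)
open import Function using (mk⇔; Equivalence)

natℚ : ℕ → ℚ
natℚ n = mkℚ (+ n) 0 (coprime-sym (1-coprimeTo n))

natℚ-mono-≤ : ∀ {m n} → m ℕ.≤ n → natℚ m ℚ.≤ natℚ n
natℚ-mono-≤ {m} {n} m≤n =
  *≤* (subst₂-≤ (ℤP.*-identityʳ (+ m)) (ℤP.*-identityʳ (+ n)) (ℤ.+≤+ m≤n))
  where
  subst₂-≤ : ∀ {a a′ b b′} → a′ ≡ a → b′ ≡ b → a ℤ.≤ b → a′ ℤ.≤ b′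
  subst₂-≤ refl refl a≤b = a≤b

natℚ-nonneg : ∀ n → 0ℚ ℚ.≤ natℚ n
natℚ-nonneg n = natℚ-mono-≤ ℕ.z≤n

≤⇒≯ : ∀ {p q} → p ℚ.≤ q → ¬ (q ℚ.< p)
≤⇒≯ p≤q q<p = ℚP.<-irrefl refl (ℚP.<-≤-trans q<p p≤q)

-- Archimedean property of ℚ: every rational lies below some natural number.
-- For q = m/(1+d) ≥ 0 take 1+m; negative q lie below 0.
archimedean : ∀ q → ∃[ n ] q ℚ.< natℚ n
archimedean (mkℚ (+ m) d _) = suc m , *<* (begin-strict
    + m ℤ.* + 1              ≡⟨ ℤP.*-identityʳ (+ m) ⟩
    + m                      <⟨ ℤ.+<+ (ℕP.n<1+n m) ⟩
    + suc m                  ≤⟨ ℤ.+≤+ (ℕP.m≤m*n (suc m) (suc d)) ⟩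
    + suc m ℤ.* + suc d      ∎)
  where open ℤP.≤-Reasoning
archimedean (mkℚ -[1+ m ] d _) =
  0 , *<* (subst (ℤ._< + 0) (sym (ℤP.*-identityʳ -[1+ m ])) ℤ.-<+)

p-1<p : ∀ p → p ℚ.- 1ℚ ℚ.< p
p-1<p p = subst (p ℚ.- 1ℚ ℚ.<_) (ℚP.+-identityʳ p)
                (ℚP.+-monoʳ-< p (ℚP.negative⁻¹ (ℚ.- 1ℚ)))

p<p+1 : ∀ p → p ℚ.< p ℚ.+ 1ℚ
p<p+1 p = subst (ℚ._< p ℚ.+ 1ℚ) (ℚP.+-identityʳ p)
                (ℚP.+-monoʳ-< p (ℚP.positive⁻¹ 1ℚ))

ratℝ : ℚ → ℝ
ratℝ c = record
  { lower      = λ q → q ℚ.< c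
  ; upper      = λ q → c ℚ.< q
  ; inhabitedˡ = c ℚ.- 1ℚ , p-1<p c
  ; inhabitedᵘ = c ℚ.+ 1ℚ , p<p+1 c
  ; roundedˡ   = λ q → mk⇔ ℚP.<-dense (λ { (r , q<r , r<c) → ℚP.<-trans q<r r<c })
  ; roundedᵘ   = λ q → mk⇔ (λ c<q → let (r , c<r , r<q) = ℚP.<-dense c<q in r , r<q , c<r)
                           (λ { (r , r<q , c<r) → ℚP.<-trans c<r r<q })
  ; disjoint   = λ q (q<c , c<q) → ℚP.<-asym q<c c<q
  ; located    = located-at
  }
  where
  located-at : ∀ q r → q ℚ.< r → q ℚ.< c ⊎ c ℚ.< r
  located-at q r q<r with ℚP.<-cmp q c
  ... | tri< q<c _ _    = inj₁ q<c
  ... | tri≈ _ refl _   = inj₂ q<r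
  ... | tri> _ _ c<q    = inj₂ (ℚP.<-trans c<q q<r)

-- Every real is strictly below some natural number: take any rational q in
-- its upper cut and a natural n above q; roundedness puts n in the upper cut.
real-bounded : ∀ (x : ℝ) → ∃[ n ] upper x (natℚ n)
real-bounded x =
  let (q , x<q) = inhabitedᵘ x
      (n , q<n) = archimedean q
  in n , Equivalence.from (roundedᵘ x (natℚ n)) (q , q<n , x<q)

⊤F : Form
⊤F = ¬' (atom 0 ∧' (¬' atom 0))

⊤F-holds : ∀ 𝓜 s → 𝓜 , s ⊨ ⊤F
⊤F-holds 𝓜 s (p₀ , ¬p₀) = ¬p₀ p₀

Lₙ⊤ : ℕ → Form
Lₙ⊤ n = L (natℚ n) (natℚ-nonneg n) ⊤F

Lₙ⊤-injective : ∀ {m n} → Lₙ⊤ m ≡ Lₙ⊤ n → m ≡ n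
Lₙ⊤-injective refl = refl

-- No state satisfies every L_n ⊤: L_0 ⊤ yields a transition of weight r,
-- and L_n ⊤ fails for a natural n above r.
Lₙ⊤-jointly-unsatisfiable : ∀ 𝓜 s → ¬ (∀ n → 𝓜 , s ⊨ Lₙ⊤ n)
Lₙ⊤-jointly-unsatisfiable 𝓜 s sat-all =
  let ((r , t , _ , s⟶t) , _) = sat-all 0
      (n , r<n)               = real-bounded r
      (_ , weights-≥n)        = sat-all n
  in weights-≥n r (t , ⊤F-holds 𝓜 t , s⟶t) r<n

self-loop : ℕ → WTS
self-loop N = record
  { State    = ⊤
  ; _⟶[_]_   = λ _ r _ → r ≡ ratℝ (natℚ N)
  ; weight≥0 = λ { refl → ≤⇒≯ (natℚ-nonneg N) }
  ; label    = λ _ _ → ⊤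
  }

self-loop-⊨ : ∀ {N n} → n ℕ.≤ N → self-loop N , tt ⊨ Lₙ⊤ n
self-loop-⊨ {N} n≤N =
  (ratℝ (natℚ N) , tt , ⊤F-holds (self-loop N) tt , refl) ,
  λ { r (_ , _ , refl) → ≤⇒≯ (natℚ-mono-≤ n≤N) }

Φ : FormSet
Φ φ = ∃[ n ] φ ≡ Lₙ⊤ n

bounded-preimages : ∀ {A : Set} {f : ℕ → A} (xs : List A) →
                    All (λ x → ∃[ n ] x ≡ f n) xs →
                    ∃[ N ] All (λ x → ∃[ n ] (x ≡ f n × n ℕ.≤ N)) xs
bounded-preimages [] [] = 0 , []
bounded-preimages (x ∷ xs) ((n , x≡fn) ∷ rest) =
  let (N , bounded) = bounded-preimages xs rest
  in n ℕ.⊔ N ,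
     (n , x≡fn , ℕP.m≤m⊔n n N) ∷
     All.map (λ { (k , y≡fk , k≤N) → k , y≡fk , ℕP.≤-trans k≤N (ℕP.m≤n⊔m n N) }) bounded

Φ-finitely-satisfiable : FinitelySatisfiable Φ
Φ-finitely-satisfiable xs xs⊆Φ =
  let (N , bounded) = bounded-preimages xs xs⊆Φ
  in self-loop N , tt , λ φ φ∈xs →
       let (n , φ≡Lₙ⊤ , n≤N) = All.lookup bounded φ∈xs
       in subst (λ ψ → self-loop N , tt ⊨ ψ) (sym φ≡Lₙ⊤) (self-loop-⊨ n≤N)

theorem4p11 : ∃[ Φ ] (Infinite Φ × FinitelySatisfiable Φ × ¬ HasModel Φ)
theorem4p11 =
  Φ ,
  (Lₙ⊤ , Lₙ⊤-injective , λ n → n , refl) ,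
  Φ-finitely-satisfiable ,
  λ { (𝓜 , s , ⊨Φ) → Lₙ⊤-jointly-unsatisfiable 𝓜 s (λ n → ⊨Φ (Lₙ⊤ n) (n , refl)) }
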